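{- For each $n \in \mathbb{N}$ define $\mathcal{G}_n(x)$ for real $x \neq 0$ by the power series identity in $t$ $$\frac{x t}{e^{x t} - 1}\,(e^t - 1) = \sum_{n=0}^{\infty} \mathcal{G}_n(x) \frac{t^n}{n!},$$ and set $\mathcal{G}_0(0) = 0$, $\mathcal{G}_n(0) = 1$ for $n \geq 1$. Then for every $n \in \mathbb{N}$, $\mathcal{G}_n$ is given by the polynomial $$\mathcal{G}_n(X) = \big(B_n(X) - B_n\big)^* = \sum_{k=0}^{n-1} \binom{n}{k} B_k X^k,$$ so in particular $\mathcal{G}_n$ is a polynomial of degree at most $n-1$.
   Context: The Bernoulli polynomials $B_n(X)$ are defined by $\frac{t e^{Xt}}{e^t - 1} = \sum_{n \ge 0} B_n(X) \frac{t^n}{n!}$, and the Bernoulli numbers are $B_n := B_n(0)$. For $P \in \mathbb{Q}[X]$, the reciprocal polynomial $P^*$ is obtained by reversing the order of the coefficients of $P$, i.e. $P^*(X) = X^{\deg P} P(1/X)$.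
   Formalization: The variable x of $\mathcal{G}_n(x)$ ranges over the rationals instead of the reals. -}

module Defs where

open import Data.Nat as ℕ using (ℕ; zero; suc; _!; _≤ᵇ_; _≡ᵇ_)
open import Data.Nat.Properties using (_!≢0)
open import Data.Nat.Combinatorics using (_C_)
open import Data.Integer using (+_)
open import Data.Rational using (ℚ; 0ℚ; 1ℚ; _+_; _*_; _-_; -_; _/_; 1/_; ≢-nonZero)
open import Data.Rational.Properties using (_≟_)
open import Data.Bool using (if_then_else_)
open import Relation.Nullary using (yes; no)

ι : ℕ → ℚ
ι n = + n / 1

-- powers in ℚ (with x ^ 0 = 1, in particular 0 ^ 0 = 1)
_^_ : ℚ → ℕ → ℚ
x ^ zero  = 1ℚ
x ^ suc n = x * (x ^ n)

inv! : ℕ → ℚ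
inv! n = (+ 1 / (n !)) {{n !≢0}}

Σ< : ℕ → (ℕ → ℚ) → ℚ
Σ< zero    h = 0ℚ
Σ< (suc n) h = Σ< n h + h n

-- Formal power series in t over ℚ, as ordinary coefficient sequences:
-- f represents Σ_n f n · t^n.

PS : Set
PS = ℕ → ℚ

onePS : PS
onePS zero    = 1ℚ
onePS (suc _) = 0ℚ

_⊕_ : PS → PS → PS
(f ⊕ g) n = f n + g n

_⊖_ : PS → PS → PS
(f ⊖ g) n = f n - g n

_·_ : ℚ → PS → PS
(c · f) n = c * f n

_⊛_ : PS → PS → PS
(f ⊛ g) n = Σ< (suc n) (λ k → f k * g (n ℕ.∸ k))

expPS : ℚ → PS
expPS c n = (c ^ n) * inv! n

-- division by t of a series with zero constant term: f(t) / t
divT : PS → PS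
divT f n = f (suc n)

-- Multiplicative inverse of a series f with f 0 = 1:
-- g 0 = 1,  g m = - Σ_{k=1}^{m} f k · g (m - k)  for m ≥ 1,
-- so that f ⊛ g = 1.  invUpTo f n is correct on all indices ≤ n.
invUpTo : PS → ℕ → PS
invUpTo f zero    m = if m ≡ᵇ 0 then 1ℚ else 0ℚ
invUpTo f (suc n) m =
  if m ≤ᵇ n then invUpTo f n m
  else (if m ≡ᵇ suc n
        then - Σ< (suc n) (λ j → f (suc j) * invUpTo f n (n ℕ.∸ j))
        else 0ℚ)

invPS : PS → PS
invPS f m = invUpTo f m m

bernoulliPS : PS
bernoulliPS = invPS (divT (expPS 1ℚ ⊖ onePS))

-- B n  (Bernoulli number, B_1 = -1/2)
B : ℕ → ℚ
B n = ι (n !) * bernoulliPS n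

Bpoly : ℕ → ℚ → ℚ
Bpoly n y = ι (n !) * (bernoulliPS ⊛ expPS y) n

-- For x ≠ 0:  x t/(e^{x t} - 1) is the inverse of the series
-- (e^{x t} - 1)/(x t) = x⁻¹ · ((e^{x t} - 1)/t), and
-- 𝒢_n(x) = n! [t^n] ( x t/(e^{x t} - 1) · (e^t - 1) ).
-- 𝒢_0(0) = 0, 𝒢_n(0) = 1 for n ≥ 1.

𝒢 : ℕ → ℚ → ℚ
𝒢 n x with x ≟ 0ℚ
... | yes _ = if n ≡ᵇ 0 then 0ℚ else 1ℚ
... | no x≢0 =
  ι (n !) * (invPS (((1/ x) {{≢-nonZero x≢0}}) · divT (expPS x ⊖ onePS))
             ⊛ (expPS 1ℚ ⊖ onePS)) n

binom : ℕ → ℕ → ℚ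
binom n k = ι (n C k)

{-# OPTIONS --safe #-}
module Submission where

-- Inverting a power series commutes with the substitution t ↦ x t, so for
-- x ≠ 0 the series x t/(e^{x t} - 1) has coefficients x^k B_k/k!.  Multiplying
-- by e^t - 1, whose constant term vanishes, gives
--   𝒢_n(x) = n! Σ_{k<n} B_k x^k / (k! (n-k)!) = Σ_{k<n} C(n,k) B_k x^k,
-- while expanding B_n(1/x) - B_n = n! Σ_{k<n} B_k x^{k-n} / (k! (n-k)!)
-- and multiplying by x^n gives the same sum.

open import Defs
open import Data.Nat using (ℕ; suc; _≤_)
open import Data.Rational using (ℚ; 0ℚ; _*_; _-_; 1/_; NonZero)
open import Data.Product using (_×_)
open import Relation.Binary.PropositionalEquality using (_≡_)

open import Algebra.Bundles using (CommutativeRing)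
import Algebra.Properties.CommutativeSemigroup as CommSemigroupProperties
open import Data.Bool using (true; false)
open import Data.Bool.Properties using (T-≡)
open import Data.Integer using (+_)
import Data.Integer.Properties as ℤP
open import Data.Nat as ℕ using (zero; _!; _<_; _∸_; _≤ᵇ_; _≡ᵇ_; s≤s)
import Data.Nat.Properties as ℕP
open import Data.Nat.Combinatorics using (_C_; k![n∸k]!∣n!)
open import Data.Nat.Combinatorics.Specification using (nCk≡n!/k![n-k]!)
open import Data.Nat.DivMod using (m*[n/m]≡n)
open import Data.Nat.Induction using (<-rec)
open import Data.Product using (_,_)
open import Data.Rational using (1ℚ; _+_; -_; _/_; toℚᵘ; ≢-nonZero)
import Data.Rational.Properties as ℚP
import Data.Rational.Unnormalised as ℚᵘ
import Data.Rational.Unnormalised.Properties as ℚᵘP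
open import Function using (case_of_)
open import Function.Bundles using (Equivalence)
open import Relation.Binary.PropositionalEquality using (_≢_; refl; sym; trans; cong; cong₂; module ≡-Reasoning)
open import Relation.Nullary using (yes; no; contradiction)

open CommSemigroupProperties (CommutativeRing.*-commutativeSemigroup ℚP.+-*-commutativeRing) using (interchange; x∙yz≈y∙xz; x∙yz≈xz∙y; xy∙z≈y∙xz)

toℚᵘ-ι : ∀ a → toℚᵘ (ι a) ℚᵘ.≃ ℚᵘ.mkℚᵘ (+ a) 0
toℚᵘ-ι a = ℚP.toℚᵘ-fromℚᵘ (ℚᵘ.mkℚᵘ (+ a) 0)

ι-* : ∀ a b → ι (a ℕ.* b) ≡ ι a * ι b
ι-* a b = ℚP.toℚᵘ-injective (begin
    toℚᵘ (ι (a ℕ.* b))                   ≈⟨ toℚᵘ-ι (a ℕ.* b) ⟩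
    ℚᵘ.mkℚᵘ (+ (a ℕ.* b)) 0              ≡⟨ cong (λ i → ℚᵘ.mkℚᵘ i 0) (ℤP.pos-* a b) ⟩
    ℚᵘ.mkℚᵘ (+ a) 0 ℚᵘ.* ℚᵘ.mkℚᵘ (+ b) 0 ≈⟨ ℚᵘP.*-cong (toℚᵘ-ι a) (toℚᵘ-ι b) ⟨
    toℚᵘ (ι a) ℚᵘ.* toℚᵘ (ι b)           ≈⟨ ℚP.toℚᵘ-homo-* (ι a) (ι b) ⟨
    toℚᵘ (ι a * ι b)                     ∎)
  where open ℚᵘP.≃-Reasoning

1/d*ι[d]≡1 : ∀ d .{{_ : ℕ.NonZero d}} → (+ 1 / d) * ι d ≡ 1ℚ
1/d*ι[d]≡1 (suc k) = ℚP.toℚᵘ-injective (begin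
    toℚᵘ ((+ 1 / suc k) * ι (suc k))          ≈⟨ ℚP.toℚᵘ-homo-* (+ 1 / suc k) (ι (suc k)) ⟩
    toℚᵘ (+ 1 / suc k) ℚᵘ.* toℚᵘ (ι (suc k))  ≈⟨ ℚᵘP.*-cong (ℚP.toℚᵘ-fromℚᵘ (ℚᵘ.mkℚᵘ (+ 1) k)) (toℚᵘ-ι (suc k)) ⟩
    ℚᵘ.1/ d′ ℚᵘ.* d′                          ≈⟨ ℚᵘP.*-inverseˡ d′ ⟩
    toℚᵘ 1ℚ                                   ∎)
  where
  open ℚᵘP.≃-Reasoning
  d′ : ℚᵘ.ℚᵘ
  d′ = ℚᵘ.mkℚᵘ (+ suc k) 0

inv!*ι!≡1 : ∀ n → inv! n * ι (n !) ≡ 1ℚ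
inv!*ι!≡1 n = 1/d*ι[d]≡1 (n !) {{ℕP._!≢0 n}}

k!*[n∸k]!*nCk≡n! : ∀ {n k} → k ≤ n → k ! ℕ.* (n ∸ k) ! ℕ.* (n C k) ≡ n !
k!*[n∸k]!*nCk≡n! {n} {k} k≤n =
  trans (cong (k ! ℕ.* (n ∸ k) ! ℕ.*_) (nCk≡n!/k![n-k]! k≤n))
        (m*[n/m]≡n {{ℕP._!*_!≢0 k (n ∸ k)}} (k![n∸k]!∣n! k≤n))

ι[n!]*inv![n∸k]≡binom*ι[k!] : ∀ {n k} → k ≤ n → ι (n !) * inv! (n ∸ k) ≡ binom n k * ι (k !)
ι[n!]*inv![n∸k]≡binom*ι[k!] {n} {k} k≤n = begin
  ι (n !) * inv! (n ∸ k)
    ≡⟨ cong (λ m → ι m * inv! (n ∸ k)) (sym (k!*[n∸k]!*nCk≡n! k≤n)) ⟩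
  ι (k ! ℕ.* (n ∸ k) ! ℕ.* (n C k)) * inv! (n ∸ k)
    ≡⟨ cong (_* inv! (n ∸ k)) (trans (ι-* (k ! ℕ.* (n ∸ k) !) (n C k)) (cong (_* binom n k) (ι-* (k !) ((n ∸ k) !)))) ⟩
  ((ι (k !) * ι ((n ∸ k) !)) * binom n k) * inv! (n ∸ k)
    ≡⟨ cong (_* inv! (n ∸ k)) (xy∙z≈y∙xz (ι (k !)) (ι ((n ∸ k) !)) (binom n k)) ⟩
  (ι ((n ∸ k) !) * (ι (k !) * binom n k)) * inv! (n ∸ k)
    ≡⟨ xy∙z≈y∙xz (ι ((n ∸ k) !)) (ι (k !) * binom n k) (inv! (n ∸ k)) ⟩
  (ι (k !) * binom n k) * (ι ((n ∸ k) !) * inv! (n ∸ k))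
    ≡⟨ cong₂ _*_ (ℚP.*-comm (ι (k !)) (binom n k)) (trans (ℚP.*-comm (ι ((n ∸ k) !)) (inv! (n ∸ k))) (inv!*ι!≡1 (n ∸ k))) ⟩
  (binom n k * ι (k !)) * 1ℚ
    ≡⟨ ℚP.*-identityʳ _ ⟩
  binom n k * ι (k !) ∎
  where open ≡-Reasoning

Σ<-cong : ∀ n {h h′ : ℕ → ℚ} → (∀ k → k < n → h k ≡ h′ k) → Σ< n h ≡ Σ< n h′
Σ<-cong zero    h≡h′ = refl
Σ<-cong (suc n) h≡h′ = cong₂ _+_ (Σ<-cong n (λ k k<n → h≡h′ k (ℕP.m<n⇒m<1+n k<n))) (h≡h′ n ℕP.≤-refl)

*-distribˡ-Σ< : ∀ n c h → c * Σ< n h ≡ Σ< n (λ k → c * h k)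
*-distribˡ-Σ< zero    c h = ℚP.*-zeroʳ c
*-distribˡ-Σ< (suc n) c h = trans (ℚP.*-distribˡ-+ c (Σ< n h) (h n)) (cong (_+ c * h n) (*-distribˡ-Σ< n c h))

Σ<-supported-at-0 : ∀ n {h : ℕ → ℚ} → (∀ k → h (suc k) ≡ 0ℚ) → Σ< (suc n) h ≡ h 0
Σ<-supported-at-0 zero    h₊≡0 = ℚP.+-identityˡ _
Σ<-supported-at-0 (suc n) h₊≡0 = trans (cong₂ _+_ (Σ<-supported-at-0 n h₊≡0) (h₊≡0 n)) (ℚP.+-identityʳ _)

^-distribˡ-+-* : ∀ x m n → x ^ (m ℕ.+ n) ≡ x ^ m * x ^ n
^-distribˡ-+-* x zero    n = sym (ℚP.*-identityˡ (x ^ n))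
^-distribˡ-+-* x (suc m) n = trans (cong (x *_) (^-distribˡ-+-* x m n)) (sym (ℚP.*-assoc x (x ^ m) (x ^ n)))

1^n≡1 : ∀ n → 1ℚ ^ n ≡ 1ℚ
1^n≡1 zero    = refl
1^n≡1 (suc n) = trans (ℚP.*-identityˡ _) (1^n≡1 n)

x^[d+k]*[1/x]^d≡x^k : ∀ x .{{_ : NonZero x}} d k → x ^ (d ℕ.+ k) * (1/ x) ^ d ≡ x ^ k
x^[d+k]*[1/x]^d≡x^k x zero    k = ℚP.*-identityʳ (x ^ k)
x^[d+k]*[1/x]^d≡x^k x (suc d) k = begin
  (x * x ^ (d ℕ.+ k)) * (1/ x * (1/ x) ^ d)  ≡⟨ interchange x (x ^ (d ℕ.+ k)) (1/ x) ((1/ x) ^ d) ⟩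
  (x * 1/ x) * (x ^ (d ℕ.+ k) * (1/ x) ^ d)  ≡⟨ cong₂ _*_ (ℚP.*-inverseʳ x) (x^[d+k]*[1/x]^d≡x^k x d k) ⟩
  1ℚ * x ^ k                                 ≡⟨ ℚP.*-identityˡ (x ^ k) ⟩
  x ^ k                                      ∎
  where open ≡-Reasoning

1+n≤ᵇn≡false : ∀ n → (suc n ≤ᵇ n) ≡ false
1+n≤ᵇn≡false zero    = refl
1+n≤ᵇn≡false (suc n) = 1+n≤ᵇn≡false n

n≡ᵇn≡true : ∀ n → (n ≡ᵇ n) ≡ true
n≡ᵇn≡true zero    = refl
n≡ᵇn≡true (suc n) = n≡ᵇn≡true n

invUpTo-stable : ∀ f d m → invUpTo f (d ℕ.+ m) m ≡ invPS f m
invUpTo-stable f zero    m = refl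
invUpTo-stable f (suc d) m
  rewrite Equivalence.to T-≡ (ℕP.≤⇒≤ᵇ (ℕP.m≤n+m m d)) = invUpTo-stable f d m

invPS-suc : ∀ f m → invPS f (suc m) ≡ - Σ< (suc m) (λ j → f (suc j) * invPS f (m ∸ j))
invPS-suc f m rewrite 1+n≤ᵇn≡false m | n≡ᵇn≡true m =
  cong -_ (Σ<-cong (suc m) (λ j j<1+m → cong (f (suc j) *_) (begin
    invUpTo f m (m ∸ j)               ≡⟨ cong (λ i → invUpTo f i (m ∸ j)) (sym (ℕP.m+[n∸m]≡n (ℕP.≤-pred j<1+m))) ⟩
    invUpTo f (j ℕ.+ (m ∸ j)) (m ∸ j) ≡⟨ invUpTo-stable f j (m ∸ j) ⟩
    invPS f (m ∸ j)                   ∎)))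
  where open ≡-Reasoning

rescale : ℚ → PS → PS
rescale c f m = c ^ m * f m

invPS-rescale : ∀ c f {g} → (∀ m → g m ≡ rescale c f m) → ∀ m → invPS g m ≡ rescale c (invPS f) m
invPS-rescale c f {g} g≡cf = <-rec _ step
  where
  open ≡-Reasoning
  step : ∀ m → (∀ {j} → j < m → invPS g j ≡ rescale c (invPS f) j) → invPS g m ≡ rescale c (invPS f) m
  step zero    _  = refl
  step (suc m) ih = begin
    invPS g (suc m)                                                  ≡⟨ invPS-suc g m ⟩
    - Σ< (suc m) (λ j → g (suc j) * invPS g (m ∸ j))                 ≡⟨ cong -_ (Σ<-cong (suc m) term) ⟩
    - Σ< (suc m) (λ j → c ^ suc m * (f (suc j) * invPS f (m ∸ j)))   ≡⟨ cong -_ (*-distribˡ-Σ< (suc m) (c ^ suc m) _) ⟨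
    - (c ^ suc m * Σ< (suc m) (λ j → f (suc j) * invPS f (m ∸ j)))   ≡⟨ ℚP.neg-distribʳ-* (c ^ suc m) _ ⟩
    c ^ suc m * - Σ< (suc m) (λ j → f (suc j) * invPS f (m ∸ j))     ≡⟨ cong (c ^ suc m *_) (invPS-suc f m) ⟨
    rescale c (invPS f) (suc m)                                      ∎
    where
    term : ∀ j → j < suc m → g (suc j) * invPS g (m ∸ j) ≡ c ^ suc m * (f (suc j) * invPS f (m ∸ j))
    term j (s≤s j≤m) = begin
      g (suc j) * invPS g (m ∸ j)
        ≡⟨ cong₂ _*_ (g≡cf (suc j)) (ih (s≤s (ℕP.m∸n≤m m j))) ⟩
      (c ^ suc j * f (suc j)) * (c ^ (m ∸ j) * invPS f (m ∸ j))
        ≡⟨ interchange (c ^ suc j) (f (suc j)) (c ^ (m ∸ j)) (invPS f (m ∸ j)) ⟩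
      (c ^ suc j * c ^ (m ∸ j)) * (f (suc j) * invPS f (m ∸ j))
        ≡⟨ cong (_* (f (suc j) * invPS f (m ∸ j))) (sym (^-distribˡ-+-* c (suc j) (m ∸ j))) ⟩
      c ^ suc (j ℕ.+ (m ∸ j)) * (f (suc j) * invPS f (m ∸ j))
        ≡⟨ cong (λ i → c ^ suc i * (f (suc j) * invPS f (m ∸ j))) (ℕP.m+[n∸m]≡n j≤m) ⟩
      c ^ suc m * (f (suc j) * invPS f (m ∸ j)) ∎

⊛-split-last : ∀ f g n → (f ⊛ g) n ≡ Σ< n (λ k → f k * g (n ∸ k)) + f n * g 0
⊛-split-last f g n = cong (λ i → Σ< n (λ k → f k * g (n ∸ k)) + f n * g i) (ℕP.n∸n≡0 n)

eᵗ-1 : PS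
eᵗ-1 = expPS 1ℚ ⊖ onePS

eᵗ-1-pos : ∀ r → 0 < r → eᵗ-1 r ≡ inv! r
eᵗ-1-pos (suc r) _ = begin
  (1ℚ * 1ℚ ^ r) * inv! (suc r) - 0ℚ  ≡⟨ ℚP.+-identityʳ _ ⟩
  (1ℚ * 1ℚ ^ r) * inv! (suc r)       ≡⟨ cong (λ u → (1ℚ * u) * inv! (suc r)) (1^n≡1 r) ⟩
  1ℚ * inv! (suc r)                  ≡⟨ ℚP.*-identityˡ _ ⟩
  inv! (suc r)                       ∎
  where open ≡-Reasoning

x⁻¹[eˣᵗ-1]/t≡rescale : ∀ x .{{_ : NonZero x}} m →
                      ((1/ x) · divT (expPS x ⊖ onePS)) m ≡ rescale x (divT eᵗ-1) m
x⁻¹[eˣᵗ-1]/t≡rescale x m = begin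
  1/ x * ((x * x ^ m) * inv! (suc m) - 0ℚ)  ≡⟨ cong (1/ x *_) (ℚP.+-identityʳ _) ⟩
  1/ x * ((x * x ^ m) * inv! (suc m))       ≡⟨ cong (1/ x *_) (ℚP.*-assoc x (x ^ m) (inv! (suc m))) ⟩
  1/ x * (x * (x ^ m * inv! (suc m)))       ≡⟨ ℚP.*-assoc (1/ x) x _ ⟨
  (1/ x * x) * (x ^ m * inv! (suc m))       ≡⟨ cong (_* (x ^ m * inv! (suc m))) (ℚP.*-inverseˡ x) ⟩
  1ℚ * (x ^ m * inv! (suc m))               ≡⟨ ℚP.*-identityˡ _ ⟩
  x ^ m * inv! (suc m)                      ≡⟨ cong (x ^ m *_) (eᵗ-1-pos (suc m) (s≤s ℕ.z≤n)) ⟨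
  rescale x (divT eᵗ-1) m                   ∎
  where open ≡-Reasoning

𝒢-coeff : ℕ → ℚ → ℚ
𝒢-coeff n x = Σ< n (λ k → rescale x bernoulliPS k * inv! (n ∸ k))

𝒢≡n!*𝒢-coeff : ∀ n x → x ≢ 0ℚ → 𝒢 n x ≡ ι (n !) * 𝒢-coeff n x
𝒢≡n!*𝒢-coeff n x x≢0 with x ℚP.≟ 0ℚ
... | yes x≡0 = contradiction x≡0 x≢0
... | no _ = cong (ι (n !) *_) (begin
  (invPS fₓ ⊛ eᵗ-1) n                                     ≡⟨ ⊛-split-last (invPS fₓ) eᵗ-1 n ⟩
  Σ< n (λ k → invPS fₓ k * eᵗ-1 (n ∸ k)) + invPS fₓ n * 0ℚ ≡⟨ cong₂ _+_ (Σ<-cong n term) (ℚP.*-zeroʳ (invPS fₓ n)) ⟩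
  𝒢-coeff n x + 0ℚ                                         ≡⟨ ℚP.+-identityʳ _ ⟩
  𝒢-coeff n x                                              ∎)
  where
  open ≡-Reasoning
  instance
    x-nonZero : NonZero x
    x-nonZero = ≢-nonZero x≢0
  fₓ : PS
  fₓ = (1/ x) · divT (expPS x ⊖ onePS)
  term : ∀ k → k < n → invPS fₓ k * eᵗ-1 (n ∸ k) ≡ rescale x bernoulliPS k * inv! (n ∸ k)
  term k k<n = cong₂ _*_ (invPS-rescale x (divT eᵗ-1) (x⁻¹[eˣᵗ-1]/t≡rescale x) k)
                         (eᵗ-1-pos (n ∸ k) (ℕP.m<n⇒0<n∸m k<n))

n!*𝒢-coeff≡Σbinom : ∀ n x → ι (n !) * 𝒢-coeff n x ≡ Σ< n (λ k → binom n k * (B k * (x ^ k)))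
n!*𝒢-coeff≡Σbinom n x =
  trans (*-distribˡ-Σ< n (ι (n !)) _) (Σ<-cong n (λ k k<n → term k (ℕP.<⇒≤ k<n)))
  where
  open ≡-Reasoning
  term : ∀ k → k ≤ n → ι (n !) * (rescale x bernoulliPS k * inv! (n ∸ k)) ≡ binom n k * (B k * (x ^ k))
  term k k≤n = begin
    ι (n !) * ((x ^ k * bernoulliPS k) * inv! (n ∸ k))
      ≡⟨ x∙yz≈xz∙y (ι (n !)) (x ^ k * bernoulliPS k) (inv! (n ∸ k)) ⟩
    (ι (n !) * inv! (n ∸ k)) * (x ^ k * bernoulliPS k)
      ≡⟨ cong (_* (x ^ k * bernoulliPS k)) (ι[n!]*inv![n∸k]≡binom*ι[k!] k≤n) ⟩
    (binom n k * ι (k !)) * (x ^ k * bernoulliPS k)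
      ≡⟨ ℚP.*-assoc (binom n k) (ι (k !)) _ ⟩
    binom n k * (ι (k !) * (x ^ k * bernoulliPS k))
      ≡⟨ cong (binom n k *_) (x∙yz≈xz∙y (ι (k !)) (x ^ k) (bernoulliPS k)) ⟩
    binom n k * (B k * (x ^ k)) ∎

p+q-q≡p : ∀ p q → p + q - q ≡ p
p+q-q≡p p q = trans (ℚP.+-assoc p q (- q)) (trans (cong (_+_ p) (ℚP.+-inverseʳ q)) (ℚP.+-identityʳ p))

x^n*[Bₙ[1/x]-Bₙ]≡n!*𝒢-coeff : ∀ n x .{{_ : NonZero x}} →
                              x ^ n * (Bpoly n (1/ x) - B n) ≡ ι (n !) * 𝒢-coeff n x
x^n*[Bₙ[1/x]-Bₙ]≡n!*𝒢-coeff n x = begin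
  x ^ n * (ι (n !) * (bernoulliPS ⊛ expPS (1/ x)) n - ι (n !) * bernoulliPS n)
    ≡⟨ cong (λ s → x ^ n * (ι (n !) * s - ι (n !) * bernoulliPS n))
            (⊛-split-last bernoulliPS (expPS (1/ x)) n) ⟩
  x ^ n * (ι (n !) * (Σ< n h + bernoulliPS n * 1ℚ) - ι (n !) * bernoulliPS n)
    ≡⟨ cong (λ s → x ^ n * (ι (n !) * (Σ< n h + s) - ι (n !) * bernoulliPS n)) (ℚP.*-identityʳ _) ⟩
  x ^ n * (ι (n !) * (Σ< n h + bernoulliPS n) - ι (n !) * bernoulliPS n)
    ≡⟨ cong (λ s → x ^ n * (s - ι (n !) * bernoulliPS n)) (ℚP.*-distribˡ-+ (ι (n !)) (Σ< n h) _) ⟩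
  x ^ n * (ι (n !) * Σ< n h + ι (n !) * bernoulliPS n - ι (n !) * bernoulliPS n)
    ≡⟨ cong (x ^ n *_) (p+q-q≡p (ι (n !) * Σ< n h) (ι (n !) * bernoulliPS n)) ⟩
  x ^ n * (ι (n !) * Σ< n h)
    ≡⟨ x∙yz≈y∙xz (x ^ n) (ι (n !)) (Σ< n h) ⟩
  ι (n !) * (x ^ n * Σ< n h)
    ≡⟨ cong (ι (n !) *_) (trans (*-distribˡ-Σ< n (x ^ n) h) (Σ<-cong n (λ k k<n → term k (ℕP.<⇒≤ k<n)))) ⟩
  ι (n !) * 𝒢-coeff n x ∎
  where
  open ≡-Reasoning
  h : ℕ → ℚ
  h k = bernoulliPS k * expPS (1/ x) (n ∸ k)
  term : ∀ k → k ≤ n → x ^ n * h k ≡ rescale x bernoulliPS k * inv! (n ∸ k)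
  term k k≤n = begin
    x ^ n * (bernoulliPS k * ((1/ x) ^ (n ∸ k) * inv! (n ∸ k)))
      ≡⟨ cong (x ^ n *_) (ℚP.*-assoc (bernoulliPS k) _ _) ⟨
    x ^ n * ((bernoulliPS k * (1/ x) ^ (n ∸ k)) * inv! (n ∸ k))
      ≡⟨ ℚP.*-assoc (x ^ n) _ _ ⟨
    (x ^ n * (bernoulliPS k * (1/ x) ^ (n ∸ k))) * inv! (n ∸ k)
      ≡⟨ cong (_* inv! (n ∸ k)) (x∙yz≈xz∙y (x ^ n) (bernoulliPS k) ((1/ x) ^ (n ∸ k))) ⟩
    ((x ^ n * (1/ x) ^ (n ∸ k)) * bernoulliPS k) * inv! (n ∸ k)
      ≡⟨ cong (λ i → ((x ^ i * (1/ x) ^ (n ∸ k)) * bernoulliPS k) * inv! (n ∸ k)) (ℕP.m∸n+n≡m k≤n) ⟨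
    ((x ^ ((n ∸ k) ℕ.+ k) * (1/ x) ^ (n ∸ k)) * bernoulliPS k) * inv! (n ∸ k)
      ≡⟨ cong (λ u → (u * bernoulliPS k) * inv! (n ∸ k)) (x^[d+k]*[1/x]^d≡x^k x (n ∸ k) k) ⟩
    (x ^ k * bernoulliPS k) * inv! (n ∸ k) ∎

𝒢-at-0 : ∀ n → 𝒢 n 0ℚ ≡ Σ< n (λ k → binom n k * (B k * (0ℚ ^ k)))
𝒢-at-0 n with 0ℚ ℚP.≟ 0ℚ
𝒢-at-0 n       | no 0≢0 = contradiction refl 0≢0
𝒢-at-0 zero    | yes _  = refl
𝒢-at-0 (suc n) | yes _  = sym (Σ<-supported-at-0 n vanish)
  where
  vanish : ∀ k → binom (suc n) (suc k) * (B (suc k) * (0ℚ * 0ℚ ^ k)) ≡ 0ℚ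
  vanish k = trans (cong (λ u → binom (suc n) (suc k) * (B (suc k) * u)) (ℚP.*-zeroˡ (0ℚ ^ k)))
                   (trans (cong (binom (suc n) (suc k) *_) (ℚP.*-zeroʳ (B (suc k))))
                          (ℚP.*-zeroʳ (binom (suc n) (suc k))))

𝒢-polynomial : ∀ n x → 𝒢 n x ≡ Σ< n (λ k → binom n k * (B k * (x ^ k)))
𝒢-polynomial n x = case x ℚP.≟ 0ℚ of λ where
  (yes refl) → 𝒢-at-0 n
  (no x≢0)   → trans (𝒢≡n!*𝒢-coeff n x x≢0) (n!*𝒢-coeff≡Σbinom n x)

proposition4 :
    (n : ℕ) →
      ((x : ℚ) → 𝒢 n x ≡ Σ< n (λ k → binom n k * (B k * (x ^ k))))
      × ((x : ℚ) → .{{_ : NonZero x}} → 1 ≤ n →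
           𝒢 n x ≡ (x ^ n) * (Bpoly n (1/ x) - B n))
proposition4 n = 𝒢-polynomial n , reciprocal
  where
  open ≡-Reasoning
  reciprocal : (x : ℚ) → .{{_ : NonZero x}} → 1 ≤ n → 𝒢 n x ≡ x ^ n * (Bpoly n (1/ x) - B n)
  reciprocal x _ = begin
    𝒢 n x                                     ≡⟨ 𝒢-polynomial n x ⟩
    Σ< n (λ k → binom n k * (B k * (x ^ k)))  ≡⟨ n!*𝒢-coeff≡Σbinom n x ⟨
    ι (n !) * 𝒢-coeff n x                     ≡⟨ x^n*[Bₙ[1/x]-Bₙ]≡n!*𝒢-coeff n x ⟨
    x ^ n * (Bpoly n (1/ x) - B n)            ∎
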